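{- Let $a$ and $d$ be positive integers with $a\ge 2$ and $\gcd(a,d)=1$, let $K$ and $k$ be positive integers with $(k-1)/2<K\le (2k-2)/3$, let $r=a+K-\lfloor (a+K)/k\rfloor k$, and assume $\lfloor (a+K)/k\rfloor\ge 2$. Then $$ g\bigl(a,a+(K+1)d,a+(K+2)d,\dots,a+k d\bigr)=\begin{cases}\dfrac{a(a+K-r)}{k}+(a+2 K+1)d&\text{if } 0\le r\le k-K-1,\\[1ex] \dfrac{a(a+K-r+k)}{k}+(a+2 K+1)d&\text{if } k-K\le r<k.\end{cases} $$
   Context: For positive integers $a_1,\dots,a_m$ with $\gcd(a_1,\dots,a_m)=1$, the Frobenius number $g(a_1,\dots,a_m)$ is the largest positive integer that cannot be written as $x_1a_1+\cdots+x_ma_m$ with nonnegative integers $x_i$. $\lfloor x\rfloor$ denotes the floor. -}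

module Defs where

open import Data.Nat using (ℕ; zero; suc; _+_; _*_; _<_)
open import Data.List using (List; []; _∷_; map; zipWith; length; upTo)
open import Data.Nat.ListAction using (sum)
open import Data.Product using (∃-syntax; _×_)
open import Relation.Nullary using (¬_)
open import Relation.Binary.PropositionalEquality using (_≡_)

Representable : List ℕ → ℕ → Set
Representable gs n =
  ∃[ xs ] (length xs ≡ length gs × sum (zipWith _*_ xs gs) ≡ n)

IsFrobeniusNumber : List ℕ → ℕ → Set
IsFrobeniusNumber gs g = ¬ Representable gs g × (∀ m → g < m → Representable gs m)

range : ℕ → ℕ → List ℕ
range lo len = map (lo +_) (upTo len)

gens : ℕ → ℕ → ℕ → ℕ → List ℕ
gens a d K k = a ∷ map (λ j → a + j * d) (range (suc K) (k Data.Nat.∸ K))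

-- A number is representable iff it is s a + t d where t is a sum of m ≤ s integers from
-- [K + 1, k], i.e. t lies in the window [m (K + 1), m k]. Since 3K + 2 ≤ 2k the windows with
-- m ≥ 2 cover every t ≥ 2K + 2, and since k ≤ 2K no window contains 2K + 1. As gcd(a, d) = 1,
-- every n is congruent modulo a to t d for some t in [2K + 2, a + 2K + 1]; with
-- Q = ⌊(a + 2K) / k⌋ this represents every n > Q a + (a + 2K + 1) d, whereas a representation
-- of that number itself would need t = 2K + 1 or more than Q generators a + j d.
-- Both cases of the theorem give this value, with Q = q for small r and Q = q + 1 otherwise.
module Submission where

open import Defs
open import Data.Nat
open import Data.Nat.Properties
open import Data.Nat.DivMod using (_%_; _/_; m≡m%n+[m/n]*n; m%n<n; m/n*n≤m; m*n/n≡m)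
open import Data.Nat.Divisibility using (_∣_; divides; ∣m+n∣m⇒∣n; n∣m*n)
open import Data.Nat.GCD using (gcd; module Bézout)
open import Data.Nat.Coprimality using (gcd≡1⇒coprime; coprime-Bézout; coprime-divisor)
open import Data.Nat.ListAction using (sum)
open import Data.Nat.Tactic.RingSolver using (solve-∀)
open import Data.List using (List; []; _∷_; map; zipWith)
open import Data.List.Membership.Propositional using (_∈_)
open import Data.List.Membership.Propositional.Properties using (∈-map⁺; ∈-upTo⁺)
open import Data.List.Relation.Unary.Any using (here; there)
open import Data.List.Relation.Unary.All as All using (All; []; _∷_)
open import Data.List.Relation.Unary.All.Properties using (map⁺; all-upTo)
open import Data.Product using (∃; ∃₂; _×_; _,_)
open import Data.Empty using (⊥; ⊥-elim)
open import Relation.Nullary using (¬_; yes; no)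
open import Relation.Binary.PropositionalEquality

representable-0 : ∀ gs → Representable gs 0
representable-0 []       = [] , refl , refl
representable-0 (_ ∷ gs) with representable-0 gs
... | xs , len , total = 0 ∷ xs , cong suc len , total

representable-+ : ∀ {gs g n} → g ∈ gs → Representable gs n → Representable gs (g + n)
representable-+ {g ∷ _} {g} (here refl) (x ∷ xs , len , total) =
  suc x ∷ xs , len , trans (+-assoc g (x * g) _) (cong (g +_) total)
representable-+ {h ∷ _} {g} (there g∈gs) (x ∷ xs , len , refl)
  with representable-+ g∈gs (xs , suc-injective len , refl)
... | ys , len′ , total = x ∷ ys , cong suc len′ ,
  trans (cong (x * h +_) total) (+-comm-middle (x * h) g _)
  where
  +-comm-middle : ∀ p q r → p + (q + r) ≡ q + (p + r)
  +-comm-middle = solve-∀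

representable-*+ : ∀ {gs g n} c → g ∈ gs → Representable gs n → Representable gs (c * g + n)
representable-*+ zero    g∈gs rep = rep
representable-*+ {gs} {g} {n} (suc c) g∈gs rep =
  subst (Representable gs) (sym (+-assoc g (c * g) n))
        (representable-+ g∈gs (representable-*+ c g∈gs rep))

-- The sums of m integers taken from [lo, hi] are exactly the t with m lo ≤ t ≤ m hi.
record Window (lo hi m t : ℕ) : Set where
  constructor window
  field
    lower : m * lo ≤ t
    upper : t ≤ m * hi

window-split : ∀ {lo hi m t} → Window lo hi (suc m) t →
  ∃₂ λ j t′ → t ≡ j + t′ × lo ≤ j × j ≤ hi × Window lo hi m t′
window-split {lo} {hi} {m} {t} (window lower upper)
  with m≤n⇒∃[o]m+o≡n (≤-trans (m≤n+m (m * lo) lo) lower)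
... | e , refl with e ≤? hi
...   | yes e≤hi =
  e , m * lo , +-comm (m * lo) e , lo≤e , e≤hi , window ≤-refl (*-monoʳ-≤ m (≤-trans lo≤e e≤hi))
  where
  lo≤e : lo ≤ e
  lo≤e = +-cancelˡ-≤ (m * lo) lo e (subst (_≤ m * lo + e) (+-comm lo (m * lo)) lower)
...   | no e≰hi with m≤n⇒∃[o]m+o≡n (<⇒≤ (≰⇒> e≰hi))
...     | f , refl =
  hi , m * lo + f , shuffle (m * lo) hi f , lo≤hi , ≤-refl ,
  window (m≤m+n (m * lo) f)
         (+-cancelˡ-≤ hi (m * lo + f) (m * hi) (subst (_≤ hi + m * hi) (shuffle (m * lo) hi f) upper))
  where
  shuffle : ∀ p q r → p + (q + r) ≡ q + (p + r)
  shuffle = solve-∀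
  lo≤hi : lo ≤ hi
  lo≤hi = *-cancelˡ-≤ (suc m) (≤-trans lower upper)

progression-combination : ∀ a d {lo hi} (js : List ℕ) → All (λ j → lo ≤ j × j ≤ hi) js → ∀ ys →
  ∃₂ λ m t → sum (zipWith _*_ ys (map (λ j → a + j * d) js)) ≡ m * a + t * d × Window lo hi m t
progression-combination a d []       _  ys       = 0 , 0 , sum-[] ys , window z≤n z≤n
  where
  sum-[] : ∀ ys → sum (zipWith _*_ ys []) ≡ 0
  sum-[] []      = refl
  sum-[] (_ ∷ _) = refl
progression-combination a d (j ∷ js) _  []       = 0 , 0 , refl , window z≤n z≤n
progression-combination a d {lo} {hi} (j ∷ js) ((lo≤j , j≤hi) ∷ bounds) (y ∷ ys)
  with progression-combination a d js bounds ys
... | m , t , total , window lower upper =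
  y + m , y * j + t , trans (cong (y * (a + j * d) +_) total) (regroup y a j d m t) ,
  window (subst (_≤ y * j + t) (sym (*-distribʳ-+ lo y m)) (+-mono-≤ (*-monoʳ-≤ y lo≤j) lower))
         (subst (y * j + t ≤_) (sym (*-distribʳ-+ hi y m)) (+-mono-≤ (*-monoʳ-≤ y j≤hi) upper))
  where
  regroup : ∀ y a j d m t → y * (a + j * d) + (m * a + t * d) ≡ (y + m) * a + (y * j + t) * d
  regroup = solve-∀

module Generators {a d K k : ℕ} (K<k : K < k) where

  progression-∈ : ∀ {j} → suc K ≤ j → j ≤ k → a + j * d ∈ gens a d K k
  progression-∈ K<j j≤k with m≤n⇒∃[o]m+o≡n K<j
  ... | i , refl = there (∈-map⁺ (λ j → a + j * d) (∈-map⁺ (suc K +_) (∈-upTo⁺ i<k∸K)))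
    where
    i<k∸K : i < k ∸ K
    i<k∸K = m+n≤o⇒m≤o∸n (suc i) (subst (_≤ k) (cong suc (+-comm K i)) j≤k)

  range-bounds : All (λ j → suc K ≤ j × j ≤ k) (range (suc K) (k ∸ K))
  range-bounds = map⁺ (All.map bounds (all-upTo (k ∸ K)))
    where
    bounds : ∀ {i} → i < k ∸ K → suc K ≤ suc K + i × suc K + i ≤ k
    bounds {i} i<k∸K = m≤m+n (suc K) i ,
      subst (_≤ k) (cong suc (+-comm i K)) (m≤o∸n⇒m+n≤o (suc i) (<⇒≤ K<k) i<k∸K)

  representable⇒window : ∀ {n} → Representable (gens a d K k) n →
    ∃ λ s → ∃₂ λ m t → n ≡ s * a + t * d × m ≤ s × Window (suc K) k m t
  representable⇒window (x ∷ ys , _ , refl) with progression-combination a d _ range-bounds ys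
  ... | m , t , total , w =
    x + m , m , t , trans (cong (x * a +_) total) (regroup x a m t d) , m≤n+m m x , w
    where
    regroup : ∀ x a m t d → x * a + (m * a + t * d) ≡ (x + m) * a + t * d
    regroup = solve-∀

  window⇒representable : ∀ {s m t} → m ≤ s → Window (suc K) k m t →
    Representable (gens a d K k) (s * a + t * d)
  window⇒representable {s} {zero} _ (window _ z≤n) =
    representable-*+ s (here refl) (representable-0 (gens a d K k))
  window⇒representable {suc s} {suc m} (s≤s m≤s) w with window-split w
  ... | j , t′ , refl , K<j , j≤k , w′ =
    subst (Representable (gens a d K k)) (regroup a j d s t′)
          (representable-+ (progression-∈ K<j j≤k) (window⇒representable m≤s w′))
    where
    regroup : ∀ a j d s t′ → a + j * d + (s * a + t′ * d) ≡ suc s * a + (j + t′) * d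
    regroup = solve-∀

gap-between-windows : ∀ {K k} → k ≤ 2 * K → ∀ m → ¬ Window (suc K) k m (suc (2 * K))
gap-between-windows k≤2K zero (window _ ())
gap-between-windows {K} {k} k≤2K 1 (window _ upper) =
  n≮n (2 * K) (≤-trans (subst (suc (2 * K) ≤_) (+-identityʳ k) upper) k≤2K)
gap-between-windows {K} k≤2K (suc (suc m)) (window lower _) =
  n≮n (suc (2 * K)) (subst (_≤ suc (2 * K)) (double-suc K)
    (≤-trans (+-monoʳ-≤ (suc K) (m≤m+n (suc K) (m * suc K))) lower))
  where
  double-suc : ∀ K → suc K + suc K ≡ suc (suc (2 * K))
  double-suc = solve-∀

3K+2≤2k⇒K<k : ∀ K k → 3 * K + 2 ≤ 2 * k → K < k
3K+2≤2k⇒K<k K k 3K+2≤2k = *-cancelˡ-≤ 2 (≤-trans 2[1+K]≤3K+2 3K+2≤2k)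
  where
  2[1+K]≤3K+2 : 2 * suc K ≤ 3 * K + 2
  2[1+K]≤3K+2 = subst (_≤ 3 * K + 2) (double-suc K) (+-monoˡ-≤ 2 (*-monoˡ-≤ K {2} {3} (s≤s (s≤s z≤n))))
    where
    double-suc : ∀ K → 2 * K + 2 ≡ 2 * suc K
    double-suc = solve-∀

module WindowCover {K k : ℕ} (3K+2≤2k : 3 * K + 2 ≤ 2 * k) where

  private
    K<k : K < k
    K<k = 3K+2≤2k⇒K<k K k 3K+2≤2k

  windows-overlap : ∀ i → (3 + i) * suc K ≤ suc ((2 + i) * k)
  windows-overlap zero    = subst (_≤ suc (2 * k)) (triple-suc K) (s≤s 3K+2≤2k)
    where
    triple-suc : ∀ K → suc (3 * K + 2) ≡ 3 * suc K
    triple-suc = solve-∀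
  windows-overlap (suc i) = subst ((4 + i) * suc K ≤_) (+-suc k _) (+-mono-≤ K<k (windows-overlap i))

  window-above : ∀ M {t} → 2 * suc K ≤ t → M * k < t → suc M * suc K ≤ t
  window-above zero          2K+2≤t _    = ≤-trans (+-monoʳ-≤ (suc K) z≤n) 2K+2≤t
  window-above 1             2K+2≤t _    = 2K+2≤t
  window-above (suc (suc i)) _      Mk<t = ≤-trans (windows-overlap i) Mk<t

  window-cover : ∀ M {t} → 2 * suc K ≤ t → t ≤ M * k → ∃ λ m → m ≤ M × Window (suc K) k m t
  window-cover zero 2K+2≤t t≤0 with ≤-trans 2K+2≤t t≤0
  ... | ()
  window-cover (suc M) {t} 2K+2≤t t≤[1+M]k with t ≤? M * k
  ... | yes t≤Mk = let m , m≤M , w = window-cover M 2K+2≤t t≤Mk in m , m≤n⇒m≤1+n m≤M , w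
  ... | no  t≰Mk = suc M , ≤-refl , window (window-above M 2K+2≤t (≰⇒> t≰Mk)) t≤[1+M]k

-- Congruence modulo a, witnessed without subtraction.
infix 4 _≡_[mod_]

record _≡_[mod_] (m n a : ℕ) : Set where
  constructor congruent
  field
    {i j} : ℕ
    equation : m + i * a ≡ n + j * a

-- Bézout's identity comes in two sign patterns; the second one is turned into the first by
-- multiplying with a - 1.
inverse-mod : ∀ {a d} .{{_ : NonZero a}} → gcd a d ≡ 1 → ∃ λ u → u * d ≡ 1 [mod a ]
inverse-mod {suc a′} {d} coprime with coprime-Bézout (gcd≡1⇒coprime coprime)
... | Bézout.-+ x y 1+xa≡yd = y , congruent {i = 0} {j = x} (trans (+-identityʳ (y * d)) (sym 1+xa≡yd))
... | Bézout.+- x y 1+yd≡xa = a′ * y , congruent {i = 1} {j = a′ * x} (begin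
  a′ * y * d + 1 * suc a′    ≡⟨ factor a′ y d ⟩
  a′ * (1 + y * d) + 1       ≡⟨ cong (λ z → a′ * z + 1) 1+yd≡xa ⟩
  a′ * (x * suc a′) + 1      ≡⟨ unfactor a′ x ⟩
  1 + a′ * x * suc a′        ∎)
  where
  open ≡-Reasoning
  factor : ∀ a′ y d → a′ * y * d + 1 * suc a′ ≡ a′ * (1 + y * d) + 1
  factor = solve-∀
  unfactor : ∀ a′ x → a′ * (x * suc a′) + 1 ≡ 1 + a′ * x * suc a′
  unfactor = solve-∀

residue-window : ∀ {a d} .{{_ : NonZero a}} → gcd a d ≡ 1 → ∀ n L →
  ∃ λ t → L ≤ t × t < L + a × n ≡ t * d [mod a ]
residue-window {suc a′} {d} coprime n L with inverse-mod {suc a′} coprime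
... | u , congruent {v} {w} inverse =
  L + X % a , m≤m+n L (X % a) , +-monoʳ-< L (m%n<n X a) ,
  congruent {i = n * w + L * d} {j = X / a * d + n * v} (sym chain)
  where
  a = suc a′
  -- X ≡ n u - L (mod a), so that (L + X % a) d ≡ n (mod a)
  X = n * u + a′ * L
  open ≡-Reasoning
  expand : ∀ a′ L c d Q n v →
    (L + c) * d + (Q * d + n * v) * suc a′ ≡ (c + Q * suc a′) * d + L * d + n * v * suc a′
  expand = solve-∀
  collect : ∀ a′ n u L d v →
    (n * u + a′ * L) * d + L * d + n * v * suc a′ ≡ n * (u * d + v * suc a′) + L * d * suc a′
  collect = solve-∀
  distribute : ∀ a′ n w L d →
    n * (1 + w * suc a′) + L * d * suc a′ ≡ n + (n * w + L * d) * suc a′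
  distribute = solve-∀
  chain : (L + X % a) * d + (X / a * d + n * v) * a ≡ n + (n * w + L * d) * a
  chain = begin
    (L + X % a) * d + (X / a * d + n * v) * a       ≡⟨ expand a′ L (X % a) d (X / a) n v ⟩
    (X % a + X / a * a) * d + L * d + n * v * a
      ≡⟨ cong (λ z → z * d + L * d + n * v * a) (sym (m≡m%n+[m/n]*n X a)) ⟩
    X * d + L * d + n * v * a                       ≡⟨ collect a′ n u L d v ⟩
    n * (u * d + v * a) + L * d * a                 ≡⟨ cong (λ z → n * z + L * d * a) inverse ⟩
    n * (1 + w * a) + L * d * a                     ≡⟨ distribute a′ n w L d ⟩
    n + (n * w + L * d) * a                         ∎

congruent-≤⇒≡+* : ∀ {a n x} → n ≡ x [mod a ] → x ≤ n → ∃ λ s → n ≡ x + s * a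
congruent-≤⇒≡+* {a} {n} {x} (congruent {A} {B} equation) x≤n with m≤n⇒∃[o]m+o≡n x≤n
... | e , refl with ∣m+n∣m⇒∣n a∣Aa+e (n∣m*n A)
  where
  a∣Aa+e : a ∣ A * a + e
  a∣Aa+e = divides B (+-cancelˡ-≡ x _ _ (trans (shuffle x A a e) equation))
    where
    shuffle : ∀ x A a e → x + (A * a + e) ≡ x + e + A * a
    shuffle = solve-∀
... | divides s e≡sa = s , cong (x +_) e≡sa

-- Q = ⌊(a + 2K) / k⌋, given by its defining inequalities.
module Frobenius (a d K k Q : ℕ) .{{_ : NonZero a}} (coprime : gcd a d ≡ 1)
  (k≤2K : k ≤ 2 * K) (3K+2≤2k : 3 * K + 2 ≤ 2 * k) (2K+2≤a : 2 * suc K ≤ a)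
  (Qk≤a+2K : Q * k ≤ a + 2 * K) (a+2K<[1+Q]k : a + 2 * K < suc Q * k) where

  open Generators {a} {d} (3K+2≤2k⇒K<k K k 3K+2≤2k)
  open WindowCover {K} {k} 3K+2≤2k

  -- 2K + 2 ≤ t ≤ T is a complete residue system modulo a.
  T : ℕ
  T = a + 2 * K + 1

  frobenius : ℕ
  frobenius = Q * a + T * d

  private
    T≤[1+Q]k : T ≤ suc Q * k
    T≤[1+Q]k = subst (_≤ suc Q * k) (+-comm 1 (a + 2 * K)) a+2K<[1+Q]k

    T≰a+2K : ¬ T ≤ a + 2 * K
    T≰a+2K T≤a+2K = n≮n (a + 2 * K) (subst (_≤ a + 2 * K) (+-comm (a + 2 * K) 1) T≤a+2K)

  no-representation-with-large-t : ∀ {s m t} → frobenius ≡ s * a + t * d → m ≤ s →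
    Window (suc K) k m t → T ≤ t → ⊥
  no-representation-with-large-t {s} {m} {t} eq m≤s (window _ upper) T≤t with m ≤? Q
  ... | yes m≤Q = T≰a+2K (≤-trans T≤t (≤-trans upper (≤-trans (*-monoˡ-≤ k m≤Q) Qk≤a+2K)))
  ... | no  m≰Q = <-irrefl eq (+-mono-<-≤ (*-monoˡ-< a Q<s) (*-monoˡ-≤ d T≤t))
    where
    Q<s : Q < s
    Q<s = <-≤-trans (≰⇒> m≰Q) m≤s

  -- T - t is a positive multiple of a below 2a, hence equal to a, and then t = 2K + 1.
  no-representation-with-small-t : ∀ {s m t} → frobenius ≡ s * a + t * d →
    Window (suc K) k m t → t < T → ⊥
  no-representation-with-small-t {s} {m} {t} eq w t<T with m≤n⇒∃[o]m+o≡n t<T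
  ... | e , 1+t+e≡T with coprime-divisor (gcd≡1⇒coprime coprime) a∣d[1+e]
    where
    a∣d[1+e] : a ∣ d * suc e
    a∣d[1+e] = ∣m+n∣m⇒∣n (divides s Qa+d[1+e]≡sa) (n∣m*n Q)
      where
      Qa+d[1+e]≡sa : Q * a + d * suc e ≡ s * a
      Qa+d[1+e]≡sa = +-cancelʳ-≡ (t * d) _ _
        (trans (split Q a d t e) (trans (cong (λ z → Q * a + z * d) 1+t+e≡T) eq))
        where
        split : ∀ Q a d t e → Q * a + d * suc e + t * d ≡ Q * a + (suc t + e) * d
        split = solve-∀
  ... | divides zero ()
  ... | divides 1 1+e≡a = gap-between-windows k≤2K m (subst (Window (suc K) k m) t≡2K+1 w)
    where
    t≡2K+1 : t ≡ suc (2 * K)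
    t≡2K+1 = +-cancelˡ-≡ a t (suc (2 * K)) (begin
      a + t             ≡⟨ cong (_+ t) (trans (sym (+-identityʳ a)) (sym 1+e≡a)) ⟩
      suc e + t         ≡⟨ +-comm (suc e) t ⟩
      t + suc e         ≡⟨ +-suc t e ⟩
      suc t + e         ≡⟨ 1+t+e≡T ⟩
      a + 2 * K + 1     ≡⟨ +-assoc a (2 * K) 1 ⟩
      a + (2 * K + 1)   ≡⟨ cong (a +_) (+-comm (2 * K) 1) ⟩
      a + suc (2 * K)   ∎)
      where open ≡-Reasoning
  ... | divides (suc (suc c)) 1+e≡[2+c]a = <⇒≱ (<-≤-trans 2K+1<2[1+K] 2K+2≤a) a≤2K+1
    where
    2a≤T : a + a ≤ T
    2a≤T = begin
      a + a             ≤⟨ +-monoʳ-≤ a (m≤m+n a (c * a)) ⟩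
      a + (a + c * a)   ≡⟨ sym 1+e≡[2+c]a ⟩
      suc e             ≤⟨ m≤n+m (suc e) t ⟩
      t + suc e         ≡⟨ +-suc t e ⟩
      suc t + e         ≡⟨ 1+t+e≡T ⟩
      T                 ∎
      where open ≤-Reasoning
    a≤2K+1 : a ≤ 2 * K + 1
    a≤2K+1 = +-cancelˡ-≤ a a (2 * K + 1) (subst (a + a ≤_) (+-assoc a (2 * K) 1) 2a≤T)
    2K+1<2[1+K] : 2 * K + 1 < 2 * suc K
    2K+1<2[1+K] = ≤-reflexive (double-suc K)
      where
      double-suc : ∀ K → suc (2 * K + 1) ≡ 2 * suc K
      double-suc = solve-∀

  not-representable : ¬ Representable (gens a d K k) frobenius
  not-representable rep with representable⇒window rep
  ... | s , m , t , eq , m≤s , w with T ≤? t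
  ... | yes T≤t = no-representation-with-large-t eq m≤s w T≤t
  ... | no  T≰t = no-representation-with-small-t {s} eq w (≰⇒> T≰t)

  quotient-above-Q : ∀ t s → frobenius < t * d + s * a → t ≤ T → Q < s
  quotient-above-Q t s F<n t≤T with s ≤? Q
  ... | no  s≰Q = ≰⇒> s≰Q
  ... | yes s≤Q = ⊥-elim (<⇒≱ F<n (subst (t * d + s * a ≤_) (+-comm (T * d) (Q * a))
                                    (+-mono-≤ (*-monoˡ-≤ d t≤T) (*-monoˡ-≤ a s≤Q))))

  representable-above : ∀ n → frobenius < n → Representable (gens a d K k) n
  representable-above n F<n =
    let t , 2K+2≤t , t<2K+2+a , n≡td = residue-window coprime n (2 * suc K)
        t≤T = ≤-pred (subst (t <_) (window-end K a) t<2K+2+a)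
        td≤n = ≤-trans (*-monoˡ-≤ d t≤T) (≤-trans (m≤n+m (T * d) (Q * a)) (<⇒≤ F<n))
        s , n≡td+sa = congruent-≤⇒≡+* n≡td td≤n
        Q<s = quotient-above-Q t s (subst (frobenius <_) n≡td+sa F<n) t≤T
        m , m≤1+Q , w = window-cover (suc Q) 2K+2≤t (≤-trans t≤T T≤[1+Q]k)
    in subst (Representable (gens a d K k)) (trans (+-comm (s * a) (t * d)) (sym n≡td+sa))
         (window⇒representable (≤-trans m≤1+Q Q<s) w)
    where
    window-end : ∀ K a → 2 * suc K + a ≡ suc (a + 2 * K + 1)
    window-end = solve-∀

  is-frobenius : IsFrobeniusNumber (gens a d K k) frobenius
  is-frobenius = not-representable , representable-above

a*[Q*k]/k≡Q*a : ∀ a Q k .{{_ : NonZero k}} → a * (Q * k) / k ≡ Q * a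
a*[Q*k]/k≡Q*a a Q k = begin
  a * (Q * k) / k   ≡⟨ cong (_/ k) (sym (*-assoc a Q k)) ⟩
  a * Q * k / k     ≡⟨ m*n/n≡m (a * Q) k ⟩
  a * Q             ≡⟨ *-comm a Q ⟩
  Q * a             ∎
  where open ≡-Reasoning

m∸1<n⇒m≤n : ∀ {m n} → m ∸ 1 < n → m ≤ n
m∸1<n⇒m≤n {zero}  _   = z≤n
m∸1<n⇒m≤n {suc m} m<n = m<n

module Division (a K k : ℕ) .{{_ : NonZero k}} where

  q : ℕ
  q = (a + K) / k

  r : ℕ
  r = a + K ∸ q * k

  private
    qk≤a+K : q * k ≤ a + K
    qk≤a+K = m/n*n≤m (a + K) k

    a+2K≡r+K+qk : a + 2 * K ≡ r + K + q * k
    a+2K≡r+K+qk = begin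
      a + 2 * K         ≡⟨ regroup a K ⟩
      a + K + K         ≡⟨ cong (_+ K) (sym (m∸n+n≡m qk≤a+K)) ⟩
      r + q * k + K     ≡⟨ +-comm-middle r (q * k) K ⟩
      r + K + q * k     ∎
      where
      open ≡-Reasoning
      regroup : ∀ a K → a + 2 * K ≡ a + K + K
      regroup = solve-∀
      +-comm-middle : ∀ x y z → x + y + z ≡ x + z + y
      +-comm-middle = solve-∀

  a+K∸r≡qk : a + K ∸ r ≡ q * k
  a+K∸r≡qk = m∸[m∸n]≡n qk≤a+K

  2[1+K]≤a : 2 ≤ q → 3 * K + 2 ≤ 2 * k → 2 * suc K ≤ a
  2[1+K]≤a 2≤q 3K+2≤2k = +-cancelʳ-≤ K (2 * suc K) a (begin
    2 * suc K + K   ≡⟨ regroup K ⟩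
    3 * K + 2       ≤⟨ 3K+2≤2k ⟩
    2 * k           ≤⟨ *-monoˡ-≤ k 2≤q ⟩
    q * k           ≤⟨ qk≤a+K ⟩
    a + K           ∎)
    where
    open ≤-Reasoning
    regroup : ∀ K → 2 * suc K + K ≡ 3 * K + 2
    regroup = solve-∀

  quotient-bounds-small-r : K < k → r ≤ k ∸ K ∸ 1 → q * k ≤ a + 2 * K × a + 2 * K < suc q * k
  quotient-bounds-small-r K<k r≤k∸K∸1 =
    ≤-trans qk≤a+K (+-monoʳ-≤ a (m≤m+n K (K + 0))) ,
    subst (_< k + q * k) (sym a+2K≡r+K+qk) (+-monoˡ-< (q * k) r+K<k)
    where
    r+K<k : r + K < k
    r+K<k = subst (_≤ k) (+-suc r K)
      (m≤o∸n⇒m+n≤o r K<k (subst (r ≤_) (trans (∸-+-assoc k K 1) (cong (k ∸_) (+-comm K 1))) r≤k∸K∸1))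

  quotient-bounds-large-r : K < k → k ∸ K ≤ r → r < k →
    suc q * k ≤ a + 2 * K × a + 2 * K < suc (suc q) * k
  quotient-bounds-large-r K<k k∸K≤r r<k =
    subst (k + q * k ≤_) (sym a+2K≡r+K+qk) (+-monoˡ-≤ (q * k) k≤r+K) ,
    subst₂ _<_ (sym a+2K≡r+K+qk) (+-assoc k k (q * k)) (+-monoˡ-< (q * k) (+-mono-<-≤ r<k (<⇒≤ K<k)))
    where
    k≤r+K : k ≤ r + K
    k≤r+K = subst (_≤ r + K) (m∸n+n≡m (<⇒≤ K<k)) (+-monoˡ-≤ K k∸K≤r)

theorem5 : (a d K k : ℕ) → .{{_ : NonZero k}} →
    2 ≤ a → 1 ≤ d → gcd a d ≡ 1 → 1 ≤ K →
    k ∸ 1 < 2 * K → 3 * K ≤ 2 * k ∸ 2 →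
    2 ≤ (a + K) / k →
    let r = a + K ∸ ((a + K) / k) * k in
    (r ≤ k ∸ K ∸ 1 →
      IsFrobeniusNumber (gens a d K k) ((a * (a + K ∸ r)) / k + (a + 2 * K + 1) * d))
    × (k ∸ K ≤ r → r < k →
      IsFrobeniusNumber (gens a d K k) ((a * (a + K ∸ r + k)) / k + (a + 2 * K + 1) * d))
theorem5 a d K k 2≤a _ coprime _ k∸1<2K 3K≤2k∸2 2≤q =
  (λ r≤k∸K∸1 → let Qk≤ , <[1+Q]k = quotient-bounds-small-r K<k r≤k∸K∸1 in
    subst (IsFrobeniusNumber (gens a d K k)) (cong (_+ (a + 2 * K + 1) * d) value-small-r)
      (frobenius-for q Qk≤ <[1+Q]k)) ,
  (λ k∸K≤r r<k → let Qk≤ , <[1+Q]k = quotient-bounds-large-r K<k k∸K≤r r<k in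
    subst (IsFrobeniusNumber (gens a d K k)) (cong (_+ (a + 2 * K + 1) * d) value-large-r)
      (frobenius-for (suc q) Qk≤ <[1+Q]k))
  where
  open Division a K k
  3K+2≤2k : 3 * K + 2 ≤ 2 * k
  3K+2≤2k = m≤o∸n⇒m+n≤o (3 * K) (*-monoʳ-≤ 2 (>-nonZero⁻¹ k)) 3K≤2k∸2
  K<k : K < k
  K<k = 3K+2≤2k⇒K<k K k 3K+2≤2k
  frobenius-for : ∀ Q → Q * k ≤ a + 2 * K → a + 2 * K < suc Q * k →
    IsFrobeniusNumber (gens a d K k) (Q * a + (a + 2 * K + 1) * d)
  frobenius-for Q = Frobenius.is-frobenius a d K k Q {{>-nonZero (≤-trans (s≤s z≤n) 2≤a)}} coprime
    (m∸1<n⇒m≤n k∸1<2K) 3K+2≤2k (2[1+K]≤a 2≤q 3K+2≤2k)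
  value-small-r : q * a ≡ a * (a + K ∸ r) / k
  value-small-r = trans (sym (a*[Q*k]/k≡Q*a a q k)) (cong (λ x → a * x / k) (sym a+K∸r≡qk))
  value-large-r : suc q * a ≡ a * (a + K ∸ r + k) / k
  value-large-r = trans (sym (a*[Q*k]/k≡Q*a a (suc q) k))
    (cong (λ x → a * x / k) (trans (+-comm k (q * k)) (cong (_+ k) (sym a+K∸r≡qk))))
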